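{- For every integer $M\geq 1$, the $\mathbb{Z}$-modules $\mathcal{M}_2^-(C_2\times C_{2M})$ and $\mathbb{M}_2^-(\Gamma(2,2M))$ are isomorphic.
   Context: For a finite abelian group $G$ with character group $G^\vee=\mathrm{Hom}(G,\mathbb{C}^\times)$ (written additively), $\mathcal{M}_2^-(G)$ is the quotient of the free $\mathbb{Z}$-module on ordered pairs $(b_1,b_2)$ of elements of $G^\vee$ with $\mathbb{Z}b_1+\mathbb{Z}b_2=G^\vee$, by the relations (O) $(b_1,b_2)=(b_2,b_1)$; (M) $(b_1,b_2)=(b_1-b_2,b_2)+(b_1,b_2-b_1)$; (A) $(b_1,b_2)=-(-b_1,b_2)$. Identify $(C_2\times C_{2M})^\vee$ with $\mathbb{Z}/2\times\mathbb{Z}/2M$, and write a pair $((a,c),(b,d))$ as the matrix $\begin{pmatrix}a&b\\c&d\end{pmatrix}$ with top row in $\mathbb{Z}/2$ and bottom row in $\mathbb{Z}/2M$. Let $\mathcal{S}_{2,1}$ be the set of such matrices whose columns generate $\mathbb{Z}/2\times\mathbb{Z}/2M$ and with $ad-bc\equiv 1\pmod 2$. $\mathbb{M}_2(\Gamma(2,2M))$ is the $\mathbb{Z}$-module generated by the elements of $\mathcal{S}_{2,1}$ subject to (1) $\begin{pmatrix}a&b\\c&d\end{pmatrix}+\begin{pmatrix}b&-a\\d&-c\end{pmatrix}=0$; (2) $\begin{pmatrix}a&b\\c&d\end{pmatrix}+\begin{pmatrix}a+b&-a\\c+d&-c\end{pmatrix}+\begin{pmatrix}b&-a-b\\d&-c-d\end{pmatrix}=0$;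 (3) $\begin{pmatrix}a&b\\c&d\end{pmatrix}=0$ whenever it equals $\begin{pmatrix}b&-a\\d&-c\end{pmatrix}$ or $\begin{pmatrix}a+b&-a\\c+d&-c\end{pmatrix}$. (This is the module of weight-2 Manin symbols for $\Gamma(2,2M)=\{\begin{pmatrix}a&b\\c&d\end{pmatrix}\in\mathrm{SL}_2(\mathbb{Z}): a\equiv1,b\equiv0\ (\mathrm{mod}\ 2),\ c\equiv0,d\equiv1\ (\mathrm{mod}\ 2M)\}$.) Then $\mathbb{M}_2^-(\Gamma(2,2M))$ is the quotient of $\mathbb{M}_2(\Gamma(2,2M))$ by the relation (O): $\begin{pmatrix}a&b\\c&d\end{pmatrix}=\begin{pmatrix}b&a\\d&c\end{pmatrix}$. -}

module Defs where

open import Data.Nat as ℕ using (ℕ; zero; suc; NonZero; _≤_; >-nonZero)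
open import Data.Nat.Properties using (m*n≢0)
open import Data.Nat.DivMod using (_mod_)
open import Data.Integer as ℤ using (ℤ; +_; _%ℕ_)
open import Data.Fin using (Fin; toℕ)
open import Data.Fin.Properties using () renaming (_≟_ to _≟ᶠ_)
open import Data.Product using (Σ; Σ-syntax; ∃; ∃₂; _×_; _,_; proj₁; proj₂)
open import Data.Product.Properties using (≡-dec)
open import Data.Sum using (_⊎_)
open import Data.List using (List; []; _∷_)
open import Relation.Nullary using (¬_; yes; no)
open import Relation.Binary.PropositionalEquality using (_≡_)
open import Relation.Binary.Definitions using (DecidableEquality)

-- A presentation consists of an ambient type `Amb` with decidable
-- equality, a predicate `Gen` singling out the generators (the free
-- ℤ-module on the generators is realised as the functions Amb → ℤ
-- vanishing outside `Gen`), an index type `Rel` of relations and, for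
-- each relation, its relator (an element of the free module).  The
-- presented module is the free module modulo the ℤ-span of the relators.

record Presentation : Set₁ where
  field
    Amb   : Set
    _≟_   : DecidableEquality Amb
    Gen   : Amb → Set
    Rel   : Set
    rel   : Rel → Amb → ℤ

module _ (P : Presentation) where
  open Presentation P

  Free : Set
  Free = Σ[ f ∈ (Amb → ℤ) ] (∀ x → ¬ Gen x → f x ≡ + 0)

  combo : List (ℤ × Rel) → Amb → ℤ
  combo []             x = + 0
  combo ((c , r) ∷ cs) x = c ℤ.* rel r x ℤ.+ combo cs x

  InSpan : (Amb → ℤ) → Set
  InSpan h = ∃ λ (cs : List (ℤ × Rel)) → ∀ x → h x ≡ combo cs x

  _≈_ : Free → Free → Set
  f ≈ g = InSpan (λ x → proj₁ f x ℤ.- proj₁ g x)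

  zeroF : Free
  zeroF = (λ _ → + 0) , (λ _ _ → _≡_.refl)

  _+F_ : Free → Free → Free
  (f , pf) +F (g , pg) = (λ x → f x ℤ.+ g x) , λ x ¬gx → fix (pf x ¬gx) (pg x ¬gx)
    where
      fix : ∀ {a b : ℤ} → a ≡ + 0 → b ≡ + 0 → a ℤ.+ b ≡ + 0
      fix _≡_.refl _≡_.refl = _≡_.refl

record _≅_ (P Q : Presentation) : Set where
  field
    to       : Free P → Free Q
    from     : Free Q → Free P
    to-cong  : ∀ f g → _≈_ P f g → _≈_ Q (to f) (to g)
    from-cong : ∀ f g → _≈_ Q f g → _≈_ P (from f) (from g)
    to-+     : ∀ f g → _≈_ Q (to (_+F_ P f g)) (_+F_ Q (to f) (to g))
    from-+   : ∀ f g → _≈_ P (from (_+F_ Q f g)) (_+F_ P (from f) (from g))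
    from-to  : ∀ f → _≈_ P (from (to f)) f
    to-from  : ∀ g → _≈_ Q (to (from g)) g

module _ (n : ℕ) .{{_ : NonZero n}} where
  reduce : ℤ → Fin n
  reduce z = (z %ℕ n) mod n

toℤ : ∀ {n} → Fin n → ℤ
toℤ x = + toℕ x

-- The group  ℤ/2 × ℤ/2M  ≅ (C₂ × C_{2M})^∨, for M ≥ 1

module Group (M : ℕ) (h : 1 ≤ M) where
  N : ℕ
  N = 2 ℕ.* M

  instance
    nzM : NonZero M
    nzM = >-nonZero h
    nzN : NonZero N
    nzN = m*n≢0 2 M

  G : Set
  G = Fin 2 × Fin N

  _+ᴳ_ : G → G → G
  (a , c) +ᴳ (b , d) = reduce 2 (toℤ a ℤ.+ toℤ b) , reduce N (toℤ c ℤ.+ toℤ d)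

  -ᴳ_ : G → G
  -ᴳ (a , c) = reduce 2 (ℤ.- toℤ a) , reduce N (ℤ.- toℤ c)

  _-ᴳ_ : G → G → G
  x -ᴳ y = x +ᴳ (-ᴳ y)

  _·ᴳ_ : ℤ → G → G
  k ·ᴳ (a , c) = reduce 2 (k ℤ.* toℤ a) , reduce N (k ℤ.* toℤ c)

  _≟ᴳ_ : DecidableEquality G
  _≟ᴳ_ = ≡-dec _≟ᶠ_ _≟ᶠ_

  -- ordered pairs (b₁ , b₂); for the Γ(2,2M) side the pair of columns
  -- of the matrix (a b ; c d) is ((a , c) , (b , d)).
  Pair : Set
  Pair = G × G

  _≟ᴾ_ : DecidableEquality Pair
  _≟ᴾ_ = ≡-dec _≟ᴳ_ _≟ᴳ_

  Generates : Pair → Set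
  Generates (b₁ , b₂) = ∀ g → ∃₂ λ (m n : ℤ) → (m ·ᴳ b₁) +ᴳ (n ·ᴳ b₂) ≡ g

  e : Pair → Pair → ℤ
  e p q with p ≟ᴾ q
  ... | yes _ = + 1
  ... | no  _ = + 0

  data Kind₁ : Set where
    O M' A : Kind₁

  relator₁ : Kind₁ → Pair → Pair → ℤ
  relator₁ O  (b₁ , b₂) x = e (b₁ , b₂) x ℤ.- e (b₂ , b₁) x
  relator₁ M' (b₁ , b₂) x =
    e (b₁ , b₂) x ℤ.- e (b₁ -ᴳ b₂ , b₂) x ℤ.- e (b₁ , b₂ -ᴳ b₁) x
  relator₁ A  (b₁ , b₂) x = e (b₁ , b₂) x ℤ.+ e (-ᴳ b₁ , b₂) x

  𝓜₂⁻ : Presentation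
  𝓜₂⁻ = record
    { Amb = Pair
    ; _≟_ = _≟ᴾ_
    ; Gen = Generates
    ; Rel = Kind₁ × Σ Pair Generates
    ; rel = λ { (k , p , _) → relator₁ k p }
    }

  DetOdd : Pair → Set
  DetOdd ((a , c) , (b , d)) = (toℤ a ℤ.* toℤ d ℤ.- toℤ b ℤ.* toℤ c) %ℕ 2 ≡ 1

  S₂₁ : Pair → Set
  S₂₁ p = Generates p × DetOdd p

  σ : Pair → Pair
  σ (b₁ , b₂) = (b₂ , -ᴳ b₁)

  τ : Pair → Pair
  τ (b₁ , b₂) = (b₁ +ᴳ b₂ , -ᴳ b₁)

  τ² : Pair → Pair
  τ² (b₁ , b₂) = (b₂ , (-ᴳ b₁) -ᴳ b₂)

  swap : Pair → Pair
  swap (b₁ , b₂) = (b₂ , b₁)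

  data Rel₂ : Set where
    r1 : Σ Pair S₂₁ → Rel₂
    r2 : Σ Pair S₂₁ → Rel₂
    r3 : (p : Pair) → S₂₁ p → (p ≡ σ p ⊎ p ≡ τ p) → Rel₂
    rO : Σ Pair S₂₁ → Rel₂

  relator₂ : Rel₂ → Pair → ℤ
  relator₂ (r1 (p , _)) x = e p x ℤ.+ e (σ p) x
  relator₂ (r2 (p , _)) x = e p x ℤ.+ e (τ p) x ℤ.+ e (τ² p) x
  relator₂ (r3 p _ _)   x = e p x
  relator₂ (rO (p , _)) x = e p x ℤ.- e (swap p) x

  𝕄₂⁻Γ : Presentation
  𝕄₂⁻Γ = record
    { Amb = Pair
    ; _≟_ = _≟ᴾ_
    ; Gen = S₂₁
    ; Rel = Rel₂
    ; rel = relator₂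
    }

-- A generating pair of ℤ/2 × ℤ/2M reduces mod 2 (the second factor through ℤ/2M → ℤ/2) to
-- a generating pair of (ℤ/2)², i.e. a matrix invertible over 𝔽₂: expressing (1,0) and (0,1)
-- in it gives a coefficient matrix inverse to it mod 2, so its determinant is odd.  Hence both
-- presentations have the same generators, and relation (3) is vacuous, since a matrix fixed by
-- σ or τ has even determinant.  The remaining relators span the same subgroup:
--   (A)(b₁,b₂) = (1)(b₁,b₂) − (O)(b₂,−b₁),      (M)(b₁,b₂) = (1)(b₁,b₂) − (2)(b₁−b₂,b₂),
--   (1)(b₁,b₂) = (A)(b₁,b₂) − (O)(−b₁,b₂),
--   (2)(b₁,b₂) = (A)(−b₁−b₂,b₂) + (O)(b₂,−b₁−b₂) − (M)(b₁+b₂,b₂),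
-- so the identity on formal combinations is an isomorphism.
module Submission where

open import Data.Empty using (⊥-elim)
open import Data.Fin using (Fin; zero; suc; toℕ)
open import Data.Fin.Properties using (toℕ-fromℕ<; toℕ-injective; toℕ<n)
open import Data.Integer using (ℤ; +_; _+_; _*_; -_; _-_; ∣_∣; _⊖_; _%ℕ_; _/ℕ_; 0ℤ; 1ℤ; -1ℤ)
open import Data.Integer.DivMod using (a≡a%ℕn+[a/ℕn]*n; n%ℕd<d)
open import Data.Integer.Divisibility.Signed
  using (_∣_; divides; ∣-trans; ∣⇒∣ᵤ; ∣ᵤ⇒∣; ∣m∣n⇒∣m+n; ∣m⇒∣-m; ∣m⇒∣m*n; ∣n⇒∣m*n)
import Data.Integer.Properties as ℤP
open import Data.Integer.Tactic.RingSolver using (solve-∀)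
open import Data.List using ([]; _∷_; _++_; map)
open import Data.Nat as ℕ using (ℕ; zero; suc; NonZero; _≤_; s≤s)
open import Data.Nat.Divisibility as ℕ∣ using (>⇒∤; m∣m*n)
open import Data.Nat.DivMod using (m<n⇒m%n≡m)
import Data.Nat.Properties as ℕP
open import Data.Product as Product using (Σ; ∃₂; _×_; _,_; proj₁; proj₂)
open import Data.Sum using ([_,_])
open import Function.Base using (_∋_)
open import Level using (0ℓ)
open import Relation.Binary.Bundles using (Setoid)
open import Relation.Binary.Definitions using (DecidableEquality)
open import Relation.Binary.PropositionalEquality
  using (_≡_; refl; sym; trans; cong; cong₂; subst; module ≡-Reasoning)
import Relation.Binary.Reasoning.Setoid as ≈-Reasoning
open import Relation.Nullary using (¬_)

open import Defs

infix 4 _≡_mod_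

-- A record rather than a synonym for + k ∣ a - b, so that a, b and k are inferable from its type.
record _≡_mod_ (a b : ℤ) (k : ℕ) : Set where
  constructor mod-by
  field divides-difference : + k ∣ a - b

module _ {k : ℕ} where

  ≡⇒≡-mod : ∀ {a b} → a ≡ b → a ≡ b mod k
  ≡⇒≡-mod {a} refl = mod-by (divides 0ℤ (ℤP.+-inverseʳ a))

  ≡-mod-refl : ∀ a → a ≡ a mod k
  ≡-mod-refl a = ≡⇒≡-mod refl

  ≡-mod-sym : ∀ {a b} → a ≡ b mod k → b ≡ a mod k
  ≡-mod-sym {a} {b} (mod-by p) = mod-by (subst (+ k ∣_) (ring a b) (∣m⇒∣-m p))
    where ring : ∀ a b → - (a - b) ≡ b - a
          ring = solve-∀

  ≡-mod-trans : ∀ {a b c} → a ≡ b mod k → b ≡ c mod k → a ≡ c mod k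
  ≡-mod-trans {a} {b} {c} (mod-by p) (mod-by q) =
    mod-by (subst (+ k ∣_) (ring a b c) (∣m∣n⇒∣m+n p q))
    where ring : ∀ a b c → (a - b) + (b - c) ≡ a - c
          ring = solve-∀

  +-cong-mod : ∀ {a b c d} → a ≡ b mod k → c ≡ d mod k → a + c ≡ b + d mod k
  +-cong-mod {a} {b} {c} {d} (mod-by p) (mod-by q) =
    mod-by (subst (+ k ∣_) (ring a b c d) (∣m∣n⇒∣m+n p q))
    where ring : ∀ a b c d → (a - b) + (c - d) ≡ (a + c) - (b + d)
          ring = solve-∀

  neg-cong-mod : ∀ {a b} → a ≡ b mod k → - a ≡ - b mod k
  neg-cong-mod {a} {b} (mod-by p) = mod-by (subst (+ k ∣_) (ring a b) (∣m⇒∣-m p))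
    where ring : ∀ a b → - (a - b) ≡ - a - - b
          ring = solve-∀

  *-cong-mod : ∀ {a b c d} → a ≡ b mod k → c ≡ d mod k → a * c ≡ b * d mod k
  *-cong-mod {a} {b} {c} {d} (mod-by p) (mod-by q) =
    mod-by (subst (+ k ∣_) (ring a b c d) (∣m∣n⇒∣m+n (∣m⇒∣m*n c p) (∣n⇒∣m*n b q)))
    where ring : ∀ a b c d → (a - b) * c + b * (c - d) ≡ a * c - b * d
          ring = solve-∀

≡-mod-setoid : ℕ → Setoid 0ℓ 0ℓ
≡-mod-setoid k = record
  { Carrier       = ℤ
  ; _≈_           = λ a b → a ≡ b mod k
  ; isEquivalence = record { refl = ≡-mod-refl _ ; sym = ≡-mod-sym ; trans = ≡-mod-trans }
  }

≡-mod-∣ : ∀ {m n a b} → m ℕ∣.∣ n → a ≡ b mod n → a ≡ b mod m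
≡-mod-∣ {m} {n} m∣n (mod-by p) = mod-by (∣-trans (∣ᵤ⇒∣ {+ m} {+ n} m∣n) p)

∣-<⇒≡0 : ∀ {k d} → k ℕ∣.∣ d → d ℕ.< k → d ≡ 0
∣-<⇒≡0 {d = zero}  _   _   = refl
∣-<⇒≡0 {d = suc _} k∣d d<k = ⊥-elim (>⇒∤ d<k k∣d)

≡-mod-<⇒≡ : ∀ {k r s} → r ℕ.< k → s ℕ.< k → + r ≡ + s mod k → r ≡ s
≡-mod-<⇒≡ {k} {r} {s} r<k s<k (mod-by k∣r-s) =
  ℤP.+-injective (ℤP.i-j≡0⇒i≡j (+ r) (+ s) (trans r-s≡r⊖s (ℤP.∣i∣≡0⇒i≡0 ∣r⊖s∣≡0)))
  where
  r-s≡r⊖s : + r - + s ≡ r ⊖ s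
  r-s≡r⊖s = ℤP.[+m]-[+n]≡m⊖n r s
  ∣r⊖s∣≡0 : ∣ r ⊖ s ∣ ≡ 0
  ∣r⊖s∣≡0 = ∣-<⇒≡0 (∣⇒∣ᵤ (subst (+ k ∣_) r-s≡r⊖s k∣r-s))
                   (ℕP.≤-<-trans (ℤP.∣m⊝n∣≤m⊔n r s) (ℕP.⊔-pres-<m r<k s<k))

module _ (k : ℕ) .{{_ : NonZero k}} where

  %ℕ-≡-mod : ∀ z → + (z %ℕ k) ≡ z mod k
  %ℕ-≡-mod z = mod-by (divides (- (z /ℕ k)) (begin
      + (z %ℕ k) - z
    ≡⟨ cong (λ w → + (z %ℕ k) - w) (a≡a%ℕn+[a/ℕn]*n z k) ⟩
      + (z %ℕ k) - (+ (z %ℕ k) + z /ℕ k * + k)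
    ≡⟨ ring (+ (z %ℕ k)) (z /ℕ k) (+ k) ⟩
      - (z /ℕ k) * + k
    ∎))
    where
    open ≡-Reasoning
    ring : ∀ r q k → r - (r + q * k) ≡ - q * k
    ring = solve-∀

  %ℕ-cong : ∀ {a b} → a ≡ b mod k → a %ℕ k ≡ b %ℕ k
  %ℕ-cong {a} {b} p = ≡-mod-<⇒≡ (n%ℕd<d a k) (n%ℕd<d b k)
    (≡-mod-trans (%ℕ-≡-mod a) (≡-mod-trans p (≡-mod-sym (%ℕ-≡-mod b))))

  toℤ-reduce : ∀ z → toℤ (reduce k z) ≡ z mod k
  toℤ-reduce z = ≡-mod-trans (≡⇒≡-mod (cong +_ toℕ-reduce)) (%ℕ-≡-mod z)
    where toℕ-reduce : toℕ (reduce k z) ≡ z %ℕ k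
          toℕ-reduce = trans (toℕ-fromℕ< _) (m<n⇒m%n≡m (n%ℕd<d z k))

  toℤ-injective-mod : ∀ {a b : Fin k} → toℤ a ≡ toℤ b mod k → a ≡ b
  toℤ-injective-mod {a} {b} p = toℕ-injective (≡-mod-<⇒≡ (toℕ<n a) (toℕ<n b) p)

unit-mod-2⇒odd : ∀ z w → z * w ≡ 1ℤ mod 2 → z %ℕ 2 ≡ 1
unit-mod-2⇒odd z w zw≡1 with z %ℕ 2 | %ℕ-≡-mod 2 z | n%ℕd<d z 2
... | 0           | 0≡z | _ =
  ⊥-elim (ℕP.0≢1+n (%ℕ-cong 2 (≡-mod-trans (*-cong-mod 0≡z (≡-mod-refl w)) zw≡1)))
... | 1           | _   | _ = refl
... | suc (suc _) | _   | s≤s (s≤s ())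

infixl 6 _⊕_
infix  8 ⊖_
infixr 7 _⊙_

data Term : Set where
  𝑥 𝑦 : Term
  _⊕_ : Term → Term → Term
  ⊖_  : Term → Term
  _⊙_ : ℤ → Term → Term

evalℤ : Term → ℤ → ℤ → ℤ
evalℤ 𝑥       a b = a
evalℤ 𝑦       a b = b
evalℤ (t ⊕ u) a b = evalℤ t a b + evalℤ u a b
evalℤ (⊖ t)   a b = - evalℤ t a b
evalℤ (c ⊙ t) a b = c * evalℤ t a b

module _ (k : ℕ) .{{_ : NonZero k}} where

  evalMod : Term → Fin k → Fin k → Fin k
  evalMod 𝑥       a b = a
  evalMod 𝑦       a b = b
  evalMod (t ⊕ u) a b = reduce k (toℤ (evalMod t a b) + toℤ (evalMod u a b))
  evalMod (⊖ t)   a b = reduce k (- toℤ (evalMod t a b))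
  evalMod (c ⊙ t) a b = reduce k (c * toℤ (evalMod t a b))

  evalMod-sound : ∀ t a b → toℤ (evalMod t a b) ≡ evalℤ t (toℤ a) (toℤ b) mod k
  evalMod-sound 𝑥       a b = ≡-mod-refl (toℤ a)
  evalMod-sound 𝑦       a b = ≡-mod-refl (toℤ b)
  evalMod-sound (t ⊕ u) a b =
    ≡-mod-trans (toℤ-reduce k _) (+-cong-mod (evalMod-sound t a b) (evalMod-sound u a b))
  evalMod-sound (⊖ t)   a b = ≡-mod-trans (toℤ-reduce k _) (neg-cong-mod (evalMod-sound t a b))
  evalMod-sound (c ⊙ t) a b =
    ≡-mod-trans (toℤ-reduce k _) (*-cong-mod (≡-mod-refl c) (evalMod-sound t a b))

  evalMod-identity : ∀ t u → (∀ a b → evalℤ t a b ≡ evalℤ u a b) →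
                     ∀ a b → evalMod t a b ≡ evalMod u a b
  evalMod-identity t u t≡u a b = toℤ-injective-mod k (begin
      toℤ (evalMod t a b)         ≈⟨ evalMod-sound t a b ⟩
      evalℤ t (toℤ a) (toℤ b)     ≡⟨ t≡u (toℤ a) (toℤ b) ⟩
      evalℤ u (toℤ a) (toℤ b)     ≈⟨ evalMod-sound u a b ⟨
      toℤ (evalMod u a b)         ∎)
    where open ≈-Reasoning (≡-mod-setoid k)

module Span (P : Presentation) where
  open Presentation P

  InSpan-resp : ∀ {f g : Amb → ℤ} → (∀ x → f x ≡ g x) → InSpan P f → InSpan P g
  InSpan-resp f≡g (cs , f≡cs) = cs , λ x → trans (sym (f≡g x)) (f≡cs x)

  InSpan-0 : InSpan P (λ _ → 0ℤ)
  InSpan-0 = [] , λ _ → refl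

  InSpan-rel : ∀ r → InSpan P (rel r)
  InSpan-rel r = (1ℤ , r) ∷ [] , λ x → sym (trans (ℤP.+-identityʳ _) (ℤP.*-identityˡ _))

  InSpan-+ : ∀ {f g} → InSpan P f → InSpan P g → InSpan P (λ x → f x + g x)
  InSpan-+ (cs , f≡cs) (ds , g≡ds) =
    cs ++ ds , λ x → trans (cong₂ _+_ (f≡cs x) (g≡ds x)) (sym (combo-++ cs x))
    where
    combo-++ : ∀ cs x → combo P (cs ++ ds) x ≡ combo P cs x + combo P ds x
    combo-++ []             x = sym (ℤP.+-identityˡ _)
    combo-++ ((c , r) ∷ cs) x =
      trans (cong (λ w → c * rel r x + w) (combo-++ cs x))
            (sym (ℤP.+-assoc (c * rel r x) (combo P cs x) (combo P ds x)))

  InSpan-* : ∀ c {f} → InSpan P f → InSpan P (λ x → c * f x)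
  InSpan-* c (cs , f≡cs) =
    map (Product.map₁ (c *_)) cs , λ x → trans (cong (c *_) (f≡cs x)) (sym (combo-* cs x))
    where
    combo-* : ∀ cs x → combo P (map (Product.map₁ (c *_)) cs) x ≡ c * combo P cs x
    combo-* []             x = sym (ℤP.*-zeroʳ c)
    combo-* ((d , r) ∷ cs) x =
      trans (cong (λ w → c * d * rel r x + w) (combo-* cs x)) (ring c d (rel r x) (combo P cs x))
      where ring : ∀ c d a b → c * d * a + c * b ≡ c * (d * a + b)
            ring = solve-∀

  InSpan-sub : ∀ {f g} → InSpan P f → InSpan P g → InSpan P (λ x → f x - g x)
  InSpan-sub f∈ g∈ = InSpan-+ f∈ (InSpan-resp (λ x → ℤP.-1*i≡-i _) (InSpan-* -1ℤ g∈))

  ≈-refl : (f : Free P) → _≈_ P f f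
  ≈-refl f = [] , λ x → ℤP.+-inverseʳ (proj₁ f x)

module _ {A : Set} (_≟_ : DecidableEquality A) where

  presentation : (A → Set) → (R : Set) → (R → A → ℤ) → Presentation
  presentation Gen R rel = record { Amb = A ; _≟_ = _≟_ ; Gen = Gen ; Rel = R ; rel = rel }

  InSpan-⊆ : ∀ {Gen₁ Gen₂ : A → Set} {R₁ R₂ : Set} {rel₁ : R₁ → A → ℤ} {rel₂ : R₂ → A → ℤ}
    → (∀ r → InSpan (presentation Gen₂ R₂ rel₂) (rel₁ r))
    → ∀ {h} → InSpan (presentation Gen₁ R₁ rel₁) h → InSpan (presentation Gen₂ R₂ rel₂) h
  InSpan-⊆ {Gen₁} {Gen₂} {R₁} {R₂} {rel₁} {rel₂} rel₁∈ (cs , h≡cs) =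
    InSpan-resp (λ x → sym (h≡cs x)) (combo∈ cs)
    where
    open Span (presentation Gen₂ R₂ rel₂)
    combo∈ : ∀ cs → InSpan (presentation Gen₂ R₂ rel₂) (combo (presentation Gen₁ R₁ rel₁) cs)
    combo∈ []             = InSpan-0
    combo∈ ((c , r) ∷ cs) = InSpan-+ (InSpan-* c (rel₁∈ r)) (combo∈ cs)

  mutually-spanning⇒≅ :
    ∀ {Gen₁ Gen₂ : A → Set} {R₁ R₂ : Set} {rel₁ : R₁ → A → ℤ} {rel₂ : R₂ → A → ℤ}
    → (∀ x → Gen₁ x → Gen₂ x) → (∀ x → Gen₂ x → Gen₁ x)
    → (∀ r → InSpan (presentation Gen₂ R₂ rel₂) (rel₁ r))
    → (∀ r → InSpan (presentation Gen₁ R₁ rel₁) (rel₂ r))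
    → presentation Gen₁ R₁ rel₁ ≅ presentation Gen₂ R₂ rel₂
  mutually-spanning⇒≅ {Gen₁} {Gen₂} {R₁} {R₂} {rel₁} {rel₂} 1⊆2 2⊆1 rel₁∈ rel₂∈ = record
    { to        = to
    ; from      = from
    ; to-cong   = λ _ _ → InSpan-⊆ rel₁∈
    ; from-cong = λ _ _ → InSpan-⊆ rel₂∈
    ; to-+      = λ f g → Span.≈-refl Q (_+F_ Q (to f) (to g))
    ; from-+    = λ f g → Span.≈-refl P (_+F_ P (from f) (from g))
    ; from-to   = Span.≈-refl P
    ; to-from   = Span.≈-refl Q
    }
    where
    P = presentation Gen₁ R₁ rel₁
    Q = presentation Gen₂ R₂ rel₂
    to : Free P → Free Q
    to (f , f-vanishes) = f , λ x ¬gen₂ → f-vanishes x (λ gen₁ → ¬gen₂ (1⊆2 x gen₁))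
    from : Free Q → Free P
    from (f , f-vanishes) = f , λ x ¬gen₁ → f-vanishes x (λ gen₂ → ¬gen₁ (2⊆1 x gen₂))

module _ (M : ℕ) (h : 1 ≤ M) where
  open Group M h

  -- Computes componentwise exactly as +ᴳ, -ᴳ and ·ᴳ do, so that evalᴳ t x y is definitionally
  -- the corresponding expression in G.
  evalᴳ : Term → G → G → G
  evalᴳ t x y = evalMod 2 t (proj₁ x) (proj₁ y) , evalMod N t (proj₂ x) (proj₂ y)

  evalᴳ-identity : ∀ t u → (∀ a b → evalℤ t a b ≡ evalℤ u a b) →
                   ∀ x y → evalᴳ t x y ≡ evalᴳ u x y
  evalᴳ-identity t u t≡u x y =
    cong₂ _,_ (evalMod-identity 2 t u t≡u _ _) (evalMod-identity N t u t≡u _ _)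

  [x-y]+y≡x : ∀ x y → (x -ᴳ y) +ᴳ y ≡ x
  [x-y]+y≡x = evalᴳ-identity (𝑥 ⊕ ⊖ 𝑦 ⊕ 𝑦) 𝑥 ((∀ a b → a + - b + b ≡ a) ∋ solve-∀)

  -[x-y]≡y-x : ∀ x y → -ᴳ (x -ᴳ y) ≡ y -ᴳ x
  -[x-y]≡y-x = evalᴳ-identity (⊖ (𝑥 ⊕ ⊖ 𝑦)) (𝑦 ⊕ ⊖ 𝑥) ((∀ a b → - (a + - b) ≡ b + - a) ∋ solve-∀)

  -[x-y]-y≡-x : ∀ x y → (-ᴳ (x -ᴳ y)) -ᴳ y ≡ -ᴳ x
  -[x-y]-y≡-x =
    evalᴳ-identity (⊖ (𝑥 ⊕ ⊖ 𝑦) ⊕ ⊖ 𝑦) (⊖ 𝑥) ((∀ a b → - (a + - b) + - b ≡ - a) ∋ solve-∀)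

  [x+y]-y≡x : ∀ x y → (x +ᴳ y) -ᴳ y ≡ x
  [x+y]-y≡x = evalᴳ-identity (𝑥 ⊕ 𝑦 ⊕ ⊖ 𝑦) 𝑥 ((∀ a b → a + b + - b ≡ a) ∋ solve-∀)

  y-[x+y]≡-x : ∀ x y → y -ᴳ (x +ᴳ y) ≡ -ᴳ x
  y-[x+y]≡-x = evalᴳ-identity (𝑦 ⊕ ⊖ (𝑥 ⊕ 𝑦)) (⊖ 𝑥) ((∀ a b → b + - (a + b) ≡ - a) ∋ solve-∀)

  -[-x-y]≡x+y : ∀ x y → -ᴳ ((-ᴳ x) -ᴳ y) ≡ x +ᴳ y
  -[-x-y]≡x+y = evalᴳ-identity (⊖ (⊖ 𝑥 ⊕ ⊖ 𝑦)) (𝑥 ⊕ 𝑦) ((∀ a b → - (- a + - b) ≡ a + b) ∋ solve-∀)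

  τ[x-y,y] : ∀ x y → τ (x -ᴳ y , y) ≡ (x , y -ᴳ x)
  τ[x-y,y] x y = cong₂ _,_ ([x-y]+y≡x x y) (-[x-y]≡y-x x y)

  τ²[x-y,y] : ∀ x y → τ² (x -ᴳ y , y) ≡ (y , -ᴳ x)
  τ²[x-y,y] x y = cong (y ,_) (-[x-y]-y≡-x x y)

  infix 4 _∈⟨_,_⟩

  _∈⟨_,_⟩ : G → G → G → Set
  g ∈⟨ x , y ⟩ = ∃₂ λ m n → (m ·ᴳ x) +ᴳ (n ·ᴳ y) ≡ g

  ∈⟨⟩-trans : ∀ {g x y x′ y′} → g ∈⟨ x , y ⟩ → x ∈⟨ x′ , y′ ⟩ → y ∈⟨ x′ , y′ ⟩ → g ∈⟨ x′ , y′ ⟩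
  ∈⟨⟩-trans {x′ = x′} {y′} (m , n , refl) (α , β , refl) (γ , δ , refl) =
    m * α + n * γ , m * β + n * δ ,
    evalᴳ-identity ((m * α + n * γ) ⊙ 𝑥 ⊕ (m * β + n * δ) ⊙ 𝑦)
                   (m ⊙ (α ⊙ 𝑥 ⊕ β ⊙ 𝑦) ⊕ n ⊙ (γ ⊙ 𝑥 ⊕ δ ⊙ 𝑦))
                   (ring m n α β γ δ) x′ y′
    where
    ring : ∀ m n α β γ δ a b → (m * α + n * γ) * a + (m * β + n * δ) * b
                              ≡ m * (α * a + β * b) + n * (γ * a + δ * b)
    ring = solve-∀

  x∈⟨x,y⟩ : ∀ x y → x ∈⟨ x , y ⟩
  x∈⟨x,y⟩ x y =
    1ℤ , 0ℤ , evalᴳ-identity (1ℤ ⊙ 𝑥 ⊕ 0ℤ ⊙ 𝑦) 𝑥 ((∀ a b → 1ℤ * a + 0ℤ * b ≡ a) ∋ solve-∀) x y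

  y∈⟨x,y⟩ : ∀ x y → y ∈⟨ x , y ⟩
  y∈⟨x,y⟩ x y =
    0ℤ , 1ℤ , evalᴳ-identity (0ℤ ⊙ 𝑥 ⊕ 1ℤ ⊙ 𝑦) 𝑦 ((∀ a b → 0ℤ * a + 1ℤ * b ≡ b) ∋ solve-∀) x y

  Generates-respects-span : ∀ {x y x′ y′} → x ∈⟨ x′ , y′ ⟩ → y ∈⟨ x′ , y′ ⟩ →
                            Generates (x , y) → Generates (x′ , y′)
  Generates-respects-span x∈ y∈ gen g = ∈⟨⟩-trans (gen g) x∈ y∈

  Generates-swap : ∀ {x y} → Generates (x , y) → Generates (y , x)
  Generates-swap {x} {y} = Generates-respects-span (y∈⟨x,y⟩ y x) (x∈⟨x,y⟩ y x)

  Generates-neg : ∀ {x y} → Generates (x , y) → Generates (-ᴳ x , y)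
  Generates-neg {x} {y} = Generates-respects-span
    (-1ℤ , 0ℤ , evalᴳ-identity (-1ℤ ⊙ ⊖ 𝑥 ⊕ 0ℤ ⊙ 𝑦) 𝑥
                  ((∀ a b → -1ℤ * - a + 0ℤ * b ≡ a) ∋ solve-∀) x y)
    (y∈⟨x,y⟩ (-ᴳ x) y)

  Generates-shear⁺ : ∀ {x y} → Generates (x , y) → Generates (x +ᴳ y , y)
  Generates-shear⁺ {x} {y} = Generates-respects-span
    (1ℤ , -1ℤ , evalᴳ-identity (1ℤ ⊙ (𝑥 ⊕ 𝑦) ⊕ -1ℤ ⊙ 𝑦) 𝑥
                  ((∀ a b → 1ℤ * (a + b) + -1ℤ * b ≡ a) ∋ solve-∀) x y)
    (y∈⟨x,y⟩ (x +ᴳ y) y)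

  Generates-shear⁻ : ∀ {x y} → Generates (x , y) → Generates (x -ᴳ y , y)
  Generates-shear⁻ {x} {y} = Generates-respects-span
    (1ℤ , 1ℤ , evalᴳ-identity (1ℤ ⊙ (𝑥 ⊕ ⊖ 𝑦) ⊕ 1ℤ ⊙ 𝑦) 𝑥
                 ((∀ a b → 1ℤ * (a + - b) + 1ℤ * b ≡ a) ∋ solve-∀) x y)
    (y∈⟨x,y⟩ (x -ᴳ y) y)

  det : Pair → ℤ
  det ((a , c) , (b , d)) = toℤ a * toℤ d - toℤ b * toℤ c

  ≡-mod-N⇒≡-mod-2 : ∀ {a b} → a ≡ b mod N → a ≡ b mod 2
  ≡-mod-N⇒≡-mod-2 = ≡-mod-∣ (m∣m*n M)

  ∈⟨⟩-mod-2 : ∀ x y {g} → ((m , n , _) : g ∈⟨ x , y ⟩) →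
      toℤ (proj₁ g) ≡ m * toℤ (proj₁ x) + n * toℤ (proj₁ y) mod 2
    × toℤ (proj₂ g) ≡ m * toℤ (proj₂ x) + n * toℤ (proj₂ y) mod 2
  ∈⟨⟩-mod-2 x y (m , n , refl) =
    evalMod-sound 2 (m ⊙ 𝑥 ⊕ n ⊙ 𝑦) _ _ , ≡-mod-N⇒≡-mod-2 (evalMod-sound N (m ⊙ 𝑥 ⊕ n ⊙ 𝑦) _ _)

  Generates⇒DetOdd : ∀ p → Generates p → DetOdd p
  Generates⇒DetOdd p@((a , c) , (b , d)) gen = unit-mod-2⇒odd (det p) (m₁ * n₂ - m₂ * n₁) (begin
      det p * (m₁ * n₂ - m₂ * n₁)
    ≡⟨ ring (toℤ a) (toℤ b) (toℤ c) (toℤ d) m₁ n₁ m₂ n₂ ⟩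
      (m₁ * toℤ a + n₁ * toℤ b) * (m₂ * toℤ c + n₂ * toℤ d)
        - (m₂ * toℤ a + n₂ * toℤ b) * (m₁ * toℤ c + n₁ * toℤ d)
    ≈⟨ +-cong-mod (*-cong-mod first₁≡1 second₂≡1) (neg-cong-mod (*-cong-mod first₂≡0 second₁≡0)) ⟩
      1ℤ * 1ℤ - 0ℤ * 0ℤ
    ∎)
    where
    open ≈-Reasoning (≡-mod-setoid 2)
    ring : ∀ A B C D m₁ n₁ m₂ n₂ → (A * D - B * C) * (m₁ * n₂ - m₂ * n₁)
         ≡ (m₁ * A + n₁ * B) * (m₂ * C + n₂ * D) - (m₂ * A + n₂ * B) * (m₁ * C + n₁ * D)
    ring = solve-∀
    e₁ e₂ : G
    e₁ = suc zero , reduce N 0ℤ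
    e₂ = zero , reduce N 1ℤ
    m₁ = proj₁ (gen e₁)
    n₁ = proj₁ (proj₂ (gen e₁))
    m₂ = proj₁ (gen e₂)
    n₂ = proj₁ (proj₂ (gen e₂))
    coords₁ = ∈⟨⟩-mod-2 (a , c) (b , d) (gen e₁)
    coords₂ = ∈⟨⟩-mod-2 (a , c) (b , d) (gen e₂)
    first₁≡1 : m₁ * toℤ a + n₁ * toℤ b ≡ 1ℤ mod 2
    first₁≡1 = ≡-mod-sym (proj₁ coords₁)
    first₂≡0 : m₂ * toℤ a + n₂ * toℤ b ≡ 0ℤ mod 2
    first₂≡0 = ≡-mod-sym (proj₁ coords₂)
    second₁≡0 : m₁ * toℤ c + n₁ * toℤ d ≡ 0ℤ mod 2
    second₁≡0 = ≡-mod-trans (≡-mod-sym (proj₂ coords₁)) (≡-mod-N⇒≡-mod-2 (toℤ-reduce N 0ℤ))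
    second₂≡1 : m₂ * toℤ c + n₂ * toℤ d ≡ 1ℤ mod 2
    second₂≡1 = ≡-mod-trans (≡-mod-sym (proj₂ coords₂)) (≡-mod-N⇒≡-mod-2 (toℤ-reduce N 1ℤ))

  DetOdd⇒¬even : ∀ p → DetOdd p → ¬ (det p ≡ 0ℤ mod 2)
  DetOdd⇒¬even p odd even = ℕP.1+n≢0 (trans (sym odd) (%ℕ-cong 2 even))

  σ-fixed⇒even : ∀ {p} → p ≡ σ p → det p ≡ 0ℤ mod 2
  σ-fixed⇒even {(a , c) , y} p≡σp = subst (λ y → det ((a , c) , y) ≡ 0ℤ mod 2) (cong proj₁ p≡σp)
    (≡⇒≡-mod (ℤP.+-inverseʳ (toℤ a * toℤ c)))

  τ-fixed⇒even : ∀ {p} → p ≡ τ p → det p ≡ 0ℤ mod 2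
  τ-fixed⇒even {(a , c) , y} p≡τp = subst (λ y → det ((a , c) , y) ≡ 0ℤ mod 2) (sym (cong proj₂ p≡τp))
    (begin
      toℤ a * toℤ (reduce N (- toℤ c)) - toℤ (reduce 2 (- toℤ a)) * toℤ c
    ≈⟨ +-cong-mod (*-cong-mod (≡-mod-refl (toℤ a)) (≡-mod-N⇒≡-mod-2 (toℤ-reduce N (- toℤ c))))
                  (neg-cong-mod (*-cong-mod (toℤ-reduce 2 (- toℤ a)) (≡-mod-refl (toℤ c)))) ⟩
      toℤ a * - toℤ c - (- toℤ a) * toℤ c
    ≡⟨ ring (toℤ a) (toℤ c) ⟩
      0ℤ
    ∎)
    where
    open ≈-Reasoning (≡-mod-setoid 2)
    ring : ∀ a c → a * - c - (- a) * c ≡ 0ℤ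
    ring = solve-∀

  Generates⇒S₂₁ : ∀ p → Generates p → S₂₁ p
  Generates⇒S₂₁ p gen = gen , Generates⇒DetOdd p gen

  as-S₂₁ : ∀ {p} → Generates p → Σ Pair S₂₁
  as-S₂₁ {p} gen = p , Generates⇒S₂₁ p gen

  a+b-[b-c]≡a+c : ∀ a b c → (a + b) - (b - c) ≡ a + c
  a+b-[b-c]≡a+c = solve-∀

  M-relator-decomposition : ∀ x y z → relator₁ M' (x , y) z
    ≡ (e (x , y) z + e (σ (x , y)) z)
      - (e (x -ᴳ y , y) z + e (τ (x -ᴳ y , y)) z + e (τ² (x -ᴳ y , y)) z)
  M-relator-decomposition x y z = begin
      e (x , y) z - e (x -ᴳ y , y) z - e (x , y -ᴳ x) z
    ≡⟨ ring (e (x , y) z) (e (x -ᴳ y , y) z) (e (x , y -ᴳ x) z) (e (y , -ᴳ x) z) ⟩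
      (e (x , y) z + e (y , -ᴳ x) z) - (e (x -ᴳ y , y) z + e (x , y -ᴳ x) z + e (y , -ᴳ x) z)
    ≡⟨ cong₂ (λ p q → (e (x , y) z + e (y , -ᴳ x) z) - (e (x -ᴳ y , y) z + e p z + e q z))
             (sym (τ[x-y,y] x y)) (sym (τ²[x-y,y] x y)) ⟩
      (e (x , y) z + e (σ (x , y)) z)
        - (e (x -ᴳ y , y) z + e (τ (x -ᴳ y , y)) z + e (τ² (x -ᴳ y , y)) z)
    ∎
    where
    open ≡-Reasoning
    ring : ∀ a b c d → a - b - c ≡ (a + d) - (b + c + d)
    ring = solve-∀

  r2-relator-decomposition : ∀ x y z → let w = (-ᴳ x) -ᴳ y in
    e (x , y) z + e (τ (x , y)) z + e (τ² (x , y)) z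
      ≡ (relator₁ A (w , y) z + relator₁ O (y , w) z) - relator₁ M' (x +ᴳ y , y) z
  r2-relator-decomposition x y z = begin
      e (x , y) z + e (x +ᴳ y , -ᴳ x) z + e (y , w) z
    ≡⟨ ring (e (x , y) z) (e (x +ᴳ y , -ᴳ x) z) (e (y , w) z) (e (w , y) z) (e (x +ᴳ y , y) z) ⟩
      (e (w , y) z + e (x +ᴳ y , y) z) + (e (y , w) z - e (w , y) z)
        - (e (x +ᴳ y , y) z - e (x , y) z - e (x +ᴳ y , -ᴳ x) z)
    ≡⟨ cong (λ p → (e (w , y) z + e (p , y) z) + (e (y , w) z - e (w , y) z)
                     - (e (x +ᴳ y , y) z - e (x , y) z - e (x +ᴳ y , -ᴳ x) z))
            (sym (-[-x-y]≡x+y x y)) ⟩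
      (e (w , y) z + e (-ᴳ w , y) z) + (e (y , w) z - e (w , y) z)
        - (e (x +ᴳ y , y) z - e (x , y) z - e (x +ᴳ y , -ᴳ x) z)
    ≡⟨ cong₂ (λ p q → (e (w , y) z + e (-ᴳ w , y) z) + (e (y , w) z - e (w , y) z)
                        - (e (x +ᴳ y , y) z - e (p , y) z - e (x +ᴳ y , q) z))
             (sym ([x+y]-y≡x x y)) (sym (y-[x+y]≡-x x y)) ⟩
      (e (w , y) z + e (-ᴳ w , y) z) + (e (y , w) z - e (w , y) z)
        - (e (x +ᴳ y , y) z - e ((x +ᴳ y) -ᴳ y , y) z - e (x +ᴳ y , y -ᴳ (x +ᴳ y)) z)
    ∎
    where
    open ≡-Reasoning
    w = (-ᴳ x) -ᴳ y
    ring : ∀ a b c d f → a + b + c ≡ (d + f) + (c - d) - (f - a - b)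
    ring = solve-∀

  module _ where
    open Span 𝕄₂⁻Γ

    𝓜-relator∈span : ∀ r → InSpan 𝕄₂⁻Γ (Presentation.rel 𝓜₂⁻ r)
    𝓜-relator∈span (O , (x , y) , gen) = InSpan-rel (rO (as-S₂₁ gen))
    𝓜-relator∈span (A , (x , y) , gen) =
      InSpan-resp (λ z → a+b-[b-c]≡a+c (e (x , y) z) (e (y , -ᴳ x) z) (e (-ᴳ x , y) z))
        (InSpan-sub (InSpan-rel (r1 (as-S₂₁ gen)))
                  (InSpan-rel (rO (as-S₂₁ (Generates-swap (Generates-neg gen))))))
    𝓜-relator∈span (M' , (x , y) , gen) =
      InSpan-resp (λ z → sym (M-relator-decomposition x y z))
        (InSpan-sub (InSpan-rel (r1 (as-S₂₁ gen))) (InSpan-rel (r2 (as-S₂₁ (Generates-shear⁻ gen)))))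

  module _ where
    open Span 𝓜₂⁻

    Γ-relator∈span : ∀ r → InSpan 𝓜₂⁻ (relator₂ r)
    Γ-relator∈span (r1 ((x , y) , gen , _)) =
      InSpan-resp (λ z → a+b-[b-c]≡a+c (e (x , y) z) (e (-ᴳ x , y) z) (e (y , -ᴳ x) z))
        (InSpan-sub (InSpan-rel (A , (x , y) , gen)) (InSpan-rel (O , (-ᴳ x , y) , Generates-neg gen)))
    Γ-relator∈span (r2 ((x , y) , gen , _)) =
      InSpan-resp (λ z → sym (r2-relator-decomposition x y z))
        (InSpan-sub (InSpan-+ (InSpan-rel (A , ((-ᴳ x) -ᴳ y , y) , gen[-x-y,y]))
                            (InSpan-rel (O , (y , (-ᴳ x) -ᴳ y) , Generates-swap gen[-x-y,y])))
                  (InSpan-rel (M' , (x +ᴳ y , y) , Generates-shear⁺ gen)))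
      where gen[-x-y,y] = Generates-shear⁻ (Generates-neg gen)
    Γ-relator∈span (r3 p (_ , odd) fixed) =
      ⊥-elim (DetOdd⇒¬even p odd ([ σ-fixed⇒even , τ-fixed⇒even ] fixed))
    Γ-relator∈span (rO ((x , y) , gen , _)) = InSpan-rel (O , (x , y) , gen)

proposition3p6 : (M : ℕ) (h : 1 ≤ M) → Group.𝓜₂⁻ M h ≅ Group.𝕄₂⁻Γ M h
proposition3p6 M h =
  mutually-spanning⇒≅ _≟ᴾ_ (Generates⇒S₂₁ M h) (λ _ → proj₁)
    (𝓜-relator∈span M h) (Γ-relator∈span M h)
  where open Group M h using (_≟ᴾ_)
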